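{- Let $Fm_m$ be the set of formulas of basic modal propositional logic and define, for $\varphi,\psi\in Fm_m$, $\varphi\equiv\psi:=\square(\varphi\rightarrow\psi)\wedge\square(\psi\rightarrow\varphi)$. Then for all $\varphi,\psi,\psi'\in Fm_m$ and every variable $x$ occurring in $\varphi$, the following are theorems of the modal system $S3$: $\varphi\equiv\varphi$; $(\varphi\equiv\psi)\rightarrow(\varphi\rightarrow\psi)$; $(\psi\equiv\psi')\rightarrow(\varphi[x:=\psi]\equiv\varphi[x:=\psi'])$. That is, propositional identity is definable by strict equivalence in $S3$.
   Context: $Fm_m$ is the set of formulas built from a countable set $V$ of propositional variables and the constants $\bot,\top$ by the connectives $\neg,\rightarrow,\vee,\wedge$ and the modal operator $\square$; $\varphi[x:=\psi]$ denotes the result of replacing every occurrence of the variable $x$ in $\varphi$ by $\psi$. The modal system $S3$ (Lemmon-style) has as axioms all substitution instances (in $Fm_m$) of classical propositional tautologies and all instances of $\square\varphi\rightarrow\varphi$, $\square(\varphi\rightarrow\psi)\rightarrow(\square\varphi\rightarrow\square\psi)$, $\square(\varphi\rightarrow\psi)\rightarrow\square(\square\varphi\rightarrow\square\psi)$; its rules are Modus Ponens and Axiom Necessitation (from an axiom $\varphi$ infer $\square\varphi$). -}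

module Defs where

open import Data.Nat using (ℕ; _≟_)
open import Data.Bool using (Bool; true; false; not; _∧_; _∨_)
open import Relation.Binary.PropositionalEquality using (_≡_)
open import Relation.Nullary using (yes; no)
open import Data.Product using (Σ; _×_)

data Fm : Set where
  var  : ℕ → Fm
  ⊥'   : Fm
  ⊤'   : Fm
  ¬'_  : Fm → Fm
  _⇒_  : Fm → Fm → Fm
  _∨'_ : Fm → Fm → Fm
  _∧'_ : Fm → Fm → Fm
  □_   : Fm → Fm

infixr 4 _⇒_
infixr 5 _∨'_
infixr 6 _∧'_
infix 7 ¬'_ □_

data Propositional : Fm → Set where
  pvar : ∀ n → Propositional (var n)
  p⊥   : Propositional ⊥'
  p⊤   : Propositional ⊤'
  p¬   : ∀ {a} → Propositional a → Propositional (¬' a)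
  p⇒   : ∀ {a b} → Propositional a → Propositional b → Propositional (a ⇒ b)
  p∨   : ∀ {a b} → Propositional a → Propositional b → Propositional (a ∨' b)
  p∧   : ∀ {a b} → Propositional a → Propositional b → Propositional (a ∧' b)

-- classical two-valued evaluation (□ never occurs in the formulas we evaluate
-- as tautologies; it is given an arbitrary value here and is irrelevant there)
eval : (ℕ → Bool) → Fm → Bool
eval v (var n)  = v n
eval v ⊥'       = false
eval v ⊤'       = true
eval v (¬' a)   = not (eval v a)
eval v (a ⇒ b)  = not (eval v a) ∨ eval v b
eval v (a ∨' b) = eval v a ∨ eval v b
eval v (a ∧' b) = eval v a ∧ eval v b
eval v (□ a)    = false

Tautology : Fm → Set
Tautology τ = Propositional τ × ((v : ℕ → Bool) → eval v τ ≡ true)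

subst : (ℕ → Fm) → Fm → Fm
subst σ (var n)  = σ n
subst σ ⊥'       = ⊥'
subst σ ⊤'       = ⊤'
subst σ (¬' a)   = ¬' subst σ a
subst σ (a ⇒ b)  = subst σ a ⇒ subst σ b
subst σ (a ∨' b) = subst σ a ∨' subst σ b
subst σ (a ∧' b) = subst σ a ∧' subst σ b
subst σ (□ a)    = □ subst σ a

_[_≔_] : Fm → ℕ → Fm → Fm
φ [ x ≔ ψ ] = subst (λ n → f n (n ≟ x)) φ
  where
  f : (n : ℕ) → _ → Fm
  f n (yes _) = ψ
  f n (no _)  = var n

data Occurs (x : ℕ) : Fm → Set where
  here : Occurs x (var x)
  o¬   : ∀ {a} → Occurs x a → Occurs x (¬' a)
  o⇒ˡ  : ∀ {a b} → Occurs x a → Occurs x (a ⇒ b)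
  o⇒ʳ  : ∀ {a b} → Occurs x b → Occurs x (a ⇒ b)
  o∨ˡ  : ∀ {a b} → Occurs x a → Occurs x (a ∨' b)
  o∨ʳ  : ∀ {a b} → Occurs x b → Occurs x (a ∨' b)
  o∧ˡ  : ∀ {a b} → Occurs x a → Occurs x (a ∧' b)
  o∧ʳ  : ∀ {a b} → Occurs x b → Occurs x (a ∧' b)
  o□   : ∀ {a} → Occurs x a → Occurs x (□ a)

data Axiom : Fm → Set where
  taut : ∀ τ σ → Tautology τ → Axiom (subst σ τ)
  T    : ∀ φ → Axiom (□ φ ⇒ φ)
  K    : ∀ φ ψ → Axiom (□ (φ ⇒ ψ) ⇒ (□ φ ⇒ □ ψ))
  S3ax : ∀ φ ψ → Axiom (□ (φ ⇒ ψ) ⇒ □ (□ φ ⇒ □ ψ))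

data S3⊢_ : Fm → Set where
  ax  : ∀ {φ} → Axiom φ → S3⊢ φ
  mp  : ∀ {φ ψ} → S3⊢ (φ ⇒ ψ) → S3⊢ φ → S3⊢ ψ
  nec : ∀ {φ} → Axiom φ → S3⊢ (□ φ)

_≡ₛ_ : Fm → Fm → Fm
φ ≡ₛ ψ = □ (φ ⇒ ψ) ∧' □ (ψ ⇒ φ)
infix 3 _≡ₛ_

-- Reflexivity needs only
-- necessitation of the tautology φ → φ, and the elimination law is the axiom
-- □φ → φ. For replacement one proves more generally that strictly equivalent
-- substitutions yield strictly equivalent formulas, by induction on φ: the
-- truth-functional connectives preserve material equivalence, a tautology that
-- K and necessitation lift under □; the □-case is exactly the S3 axiom
-- □(φ → ψ) → □(□φ → □ψ), which makes strict implication itself strictly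
-- monotone under □.
module Submission where

open import Defs
open import Data.Nat using (ℕ; zero; suc; _<_; _<ᵇ_; _≟_; z<s; s<s)
open import Data.Nat.Properties using (<ᵇ⇒<)
open import Data.Bool using (Bool; true; false; not; _∧_; _∨_) renaming (T to IsTrue)
open import Data.Bool.Properties using (T-∧; T-≡)
open import Data.Product using (_×_; _,_; proj₁; proj₂)
open import Data.Vec using (Vec; []; _∷_)
open import Function using (_∘_; Equivalence)
open import Relation.Binary.PropositionalEquality using (_≡_; refl; sym; cong; cong₂; module ≡-Reasoning)
open import Relation.Nullary using (yes; no)

IsTrue-∧⇒× : ∀ {x y} → IsTrue (x ∧ y) → IsTrue x × IsTrue y
IsTrue-∧⇒× = Equivalence.to T-∧

lookupOr : ∀ {A : Set} {k} → A → Vec A k → ℕ → A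
lookupOr d []       n       = d
lookupOr d (x ∷ xs) zero    = x
lookupOr d (x ∷ xs) (suc n) = lookupOr d xs n

prefix : ∀ {A : Set} k → (ℕ → A) → Vec A k
prefix zero    v = []
prefix (suc k) v = v 0 ∷ prefix k (v ∘ suc)

lookupOr-prefix : ∀ {A : Set} {d : A} {k n} (v : ℕ → A) → n < k → lookupOr d (prefix k v) n ≡ v n
lookupOr-prefix {n = zero}  v z<s       = refl
lookupOr-prefix {n = suc n} v (s<s n<k) = lookupOr-prefix (v ∘ suc) n<k

allBoolVecs : ∀ k → (Vec Bool k → Bool) → Bool
allBoolVecs zero    f = f []
allBoolVecs (suc k) f = allBoolVecs k (f ∘ (true ∷_)) ∧ allBoolVecs k (f ∘ (false ∷_))

allBoolVecs-sound : ∀ {k} (f : Vec Bool k → Bool) → IsTrue (allBoolVecs k f) → ∀ bs → IsTrue (f bs)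
allBoolVecs-sound f t []           = t
allBoolVecs-sound f t (true ∷ bs)  = allBoolVecs-sound (f ∘ (true ∷_)) (proj₁ (IsTrue-∧⇒× t)) bs
allBoolVecs-sound f t (false ∷ bs) = allBoolVecs-sound (f ∘ (false ∷_)) (proj₂ (IsTrue-∧⇒× t)) bs

propositionalIn : ℕ → Fm → Bool
propositionalIn k (var n)  = n <ᵇ k
propositionalIn k ⊥'       = true
propositionalIn k ⊤'       = true
propositionalIn k (¬' a)   = propositionalIn k a
propositionalIn k (a ⇒ b)  = propositionalIn k a ∧ propositionalIn k b
propositionalIn k (a ∨' b) = propositionalIn k a ∧ propositionalIn k b
propositionalIn k (a ∧' b) = propositionalIn k a ∧ propositionalIn k b
propositionalIn k (□ a)    = false

propositionalIn⇒Propositional : ∀ {k} τ → IsTrue (propositionalIn k τ) → Propositional τ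
propositionalIn⇒Propositional (var n)  t = pvar n
propositionalIn⇒Propositional ⊥'       t = p⊥
propositionalIn⇒Propositional ⊤'       t = p⊤
propositionalIn⇒Propositional (¬' a)   t = p¬ (propositionalIn⇒Propositional a t)
propositionalIn⇒Propositional (a ⇒ b)  t =
  p⇒ (propositionalIn⇒Propositional a (proj₁ (IsTrue-∧⇒× t))) (propositionalIn⇒Propositional b (proj₂ (IsTrue-∧⇒× t)))
propositionalIn⇒Propositional (a ∨' b) t =
  p∨ (propositionalIn⇒Propositional a (proj₁ (IsTrue-∧⇒× t))) (propositionalIn⇒Propositional b (proj₂ (IsTrue-∧⇒× t)))
propositionalIn⇒Propositional (a ∧' b) t =
  p∧ (propositionalIn⇒Propositional a (proj₁ (IsTrue-∧⇒× t))) (propositionalIn⇒Propositional b (proj₂ (IsTrue-∧⇒× t)))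

eval-cong : ∀ {k} {v w : ℕ → Bool} τ → IsTrue (propositionalIn k τ) →
            (∀ {n} → n < k → v n ≡ w n) → eval v τ ≡ eval w τ
eval-cong {k} (var n) t v≗w = v≗w (<ᵇ⇒< n k t)
eval-cong ⊥'       t v≗w = refl
eval-cong ⊤'       t v≗w = refl
eval-cong (¬' a)   t v≗w = cong not (eval-cong a t v≗w)
eval-cong (a ⇒ b)  t v≗w =
  cong₂ (λ x y → not x ∨ y) (eval-cong a (proj₁ (IsTrue-∧⇒× t)) v≗w) (eval-cong b (proj₂ (IsTrue-∧⇒× t)) v≗w)
eval-cong (a ∨' b) t v≗w = cong₂ _∨_ (eval-cong a (proj₁ (IsTrue-∧⇒× t)) v≗w) (eval-cong b (proj₂ (IsTrue-∧⇒× t)) v≗w)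
eval-cong (a ∧' b) t v≗w = cong₂ _∧_ (eval-cong a (proj₁ (IsTrue-∧⇒× t)) v≗w) (eval-cong b (proj₂ (IsTrue-∧⇒× t)) v≗w)

validIn : ℕ → Fm → Bool
validIn k τ = propositionalIn k τ ∧ allBoolVecs k (λ bs → eval (lookupOr false bs) τ)

validIn⇒Tautology : ∀ k τ → IsTrue (validIn k τ) → Tautology τ
validIn⇒Tautology k τ t = propositionalIn⇒Propositional τ prop , true-everywhere
  where
  open ≡-Reasoning
  prop = proj₁ (IsTrue-∧⇒× t)
  true-everywhere : (v : ℕ → Bool) → eval v τ ≡ true
  true-everywhere v = begin
    eval v τ                              ≡⟨ eval-cong τ prop (λ n<k → sym (lookupOr-prefix v n<k)) ⟩
    eval (lookupOr false (prefix k v)) τ  ≡⟨ Equivalence.to T-≡ (allBoolVecs-sound _ (proj₂ (IsTrue-∧⇒× t)) (prefix k v)) ⟩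
    true                                  ∎

-- Schematic letters: an instance of a tautology in A … D substitutes the
-- formulas of a vector for them (the default ⊥' is never reached).
A B C D : Fm
A = var 0
B = var 1
C = var 2
D = var 3

tautologyInstance : ∀ {k} τ (ψs : Vec Fm k) → {IsTrue (validIn k τ)} → Axiom (subst (lookupOr ⊥' ψs) τ)
tautologyInstance {k} τ ψs {t} = taut τ (lookupOr ⊥' ψs) (validIn⇒Tautology k τ t)

_⊢_ : Fm → Fm → Set
e ⊢ φ = S3⊢ (e ⇒ φ)
infix 2 _⊢_

_⇔_ : Fm → Fm → Fm
φ ⇔ ψ = (φ ⇒ ψ) ∧' (ψ ⇒ φ)
infix 5 _⇔_

⇒-refl-axiom : ∀ φ → Axiom (φ ⇒ φ)
⇒-refl-axiom φ = tautologyInstance (A ⇒ A) (φ ∷ [])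

mp₂ : ∀ {φ ψ χ} → S3⊢ (φ ⇒ ψ ⇒ χ) → S3⊢ φ → S3⊢ ψ → S3⊢ χ
mp₂ h h₁ h₂ = mp (mp h h₁) h₂

∧-intro : ∀ {φ ψ} → S3⊢ φ → S3⊢ ψ → S3⊢ (φ ∧' ψ)
∧-intro {φ} {ψ} = mp₂ (ax (tautologyInstance (A ⇒ B ⇒ A ∧' B) (φ ∷ ψ ∷ [])))

⊢-refl : ∀ {e} → e ⊢ e
⊢-refl {e} = ax (⇒-refl-axiom e)

⊢-trans : ∀ {φ ψ χ} → φ ⊢ ψ → ψ ⊢ χ → φ ⊢ χ
⊢-trans {φ} {ψ} {χ} = mp₂ (ax (tautologyInstance ((A ⇒ B) ⇒ (B ⇒ C) ⇒ (A ⇒ C)) (φ ∷ ψ ∷ χ ∷ [])))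

⊢-weaken : ∀ {e φ} → S3⊢ φ → e ⊢ φ
⊢-weaken {e} {φ} = mp (ax (tautologyInstance (A ⇒ B ⇒ A) (φ ∷ e ∷ [])))

⊢-mp₂ : ∀ {e φ ψ χ} → S3⊢ (φ ⇒ ψ ⇒ χ) → e ⊢ φ → e ⊢ ψ → e ⊢ χ
⊢-mp₂ {e} {φ} {ψ} {χ} h h₁ h₂ =
  mp (mp₂ (ax (tautologyInstance ((A ⇒ B) ⇒ (A ⇒ C) ⇒ (B ⇒ C ⇒ D) ⇒ (A ⇒ D)) (e ∷ φ ∷ ψ ∷ χ ∷ []))) h₁ h₂) h

⊢-∧-intro : ∀ {e φ ψ} → e ⊢ φ → e ⊢ ψ → e ⊢ φ ∧' ψ
⊢-∧-intro {φ = φ} {ψ} = ⊢-mp₂ (ax (tautologyInstance (A ⇒ B ⇒ A ∧' B) (φ ∷ ψ ∷ [])))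

⊢-∧-elimˡ : ∀ {e φ ψ} → e ⊢ φ ∧' ψ → e ⊢ φ
⊢-∧-elimˡ {φ = φ} {ψ} h = ⊢-trans h (ax (tautologyInstance (A ∧' B ⇒ A) (φ ∷ ψ ∷ [])))

⊢-∧-elimʳ : ∀ {e φ ψ} → e ⊢ φ ∧' ψ → e ⊢ ψ
⊢-∧-elimʳ {φ = φ} {ψ} h = ⊢-trans h (ax (tautologyInstance (A ∧' B ⇒ B) (φ ∷ ψ ∷ [])))

□-mono : ∀ {e φ ψ} → e ⊢ □ φ → Axiom (φ ⇒ ψ) → e ⊢ □ ψ
□-mono {φ = φ} {ψ} h α = ⊢-trans h (mp (ax (K φ ψ)) (nec α))

□-mono₂ : ∀ {e φ ψ χ} → e ⊢ □ φ → e ⊢ □ ψ → Axiom (φ ⇒ ψ ⇒ χ) → e ⊢ □ χ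
□-mono₂ {φ = φ} {ψ} {χ} h₁ h₂ α = ⊢-mp₂ □φ⇒□ψ⇒□χ h₁ h₂
  where
  □φ⇒□ψ⇒□χ : S3⊢ (□ φ ⇒ □ ψ ⇒ □ χ)
  □φ⇒□ψ⇒□χ = ⊢-trans (mp (ax (K φ (ψ ⇒ χ))) (nec α)) (ax (K ψ χ))

≡ₛ-refl : ∀ φ → S3⊢ (φ ≡ₛ φ)
≡ₛ-refl φ = ∧-intro (nec (⇒-refl-axiom φ)) (nec (⇒-refl-axiom φ))

≡ₛ-elim : ∀ φ ψ → S3⊢ ((φ ≡ₛ ψ) ⇒ (φ ⇒ ψ))
≡ₛ-elim φ ψ = ⊢-trans (⊢-∧-elimˡ ⊢-refl) (ax (T (φ ⇒ ψ)))

≡ₛ-sym : ∀ {e φ ψ} → e ⊢ φ ≡ₛ ψ → e ⊢ ψ ≡ₛ φ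
≡ₛ-sym h = ⊢-∧-intro (⊢-∧-elimʳ h) (⊢-∧-elimˡ h)

≡ₛ⇒□⇔ : ∀ {e φ ψ} → e ⊢ φ ≡ₛ ψ → e ⊢ □ (φ ⇔ ψ)
≡ₛ⇒□⇔ {φ = φ} {ψ} h =
  □-mono₂ (⊢-∧-elimˡ h) (⊢-∧-elimʳ h) (tautologyInstance (A ⇒ B ⇒ A ∧' B) ((φ ⇒ ψ) ∷ (ψ ⇒ φ) ∷ []))

≡ₛ-cong₁ : ∀ {e φ φ'} (f : Fm → Fm) → (∀ a a' → Axiom ((a ⇔ a') ⇒ (f a ⇒ f a'))) →
           e ⊢ φ ≡ₛ φ' → e ⊢ f φ ≡ₛ f φ'
≡ₛ-cong₁ f mono h = ⊢-∧-intro (□-mono (≡ₛ⇒□⇔ h) (mono _ _)) (□-mono (≡ₛ⇒□⇔ (≡ₛ-sym h)) (mono _ _))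

≡ₛ-cong₂ : ∀ {e φ φ' ψ ψ'} (f : Fm → Fm → Fm) →
           (∀ a a' b b' → Axiom ((a ⇔ a') ⇒ (b ⇔ b') ⇒ (f a b ⇒ f a' b'))) →
           e ⊢ φ ≡ₛ φ' → e ⊢ ψ ≡ₛ ψ' → e ⊢ f φ ψ ≡ₛ f φ' ψ'
≡ₛ-cong₂ f mono h₁ h₂ =
  ⊢-∧-intro (□-mono₂ (≡ₛ⇒□⇔ h₁) (≡ₛ⇒□⇔ h₂) (mono _ _ _ _))
            (□-mono₂ (≡ₛ⇒□⇔ (≡ₛ-sym h₁)) (≡ₛ⇒□⇔ (≡ₛ-sym h₂)) (mono _ _ _ _))

≡ₛ-cong-□ : ∀ {e φ φ'} → e ⊢ φ ≡ₛ φ' → e ⊢ □ φ ≡ₛ □ φ'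
≡ₛ-cong-□ {φ = φ} {φ'} h =
  ⊢-∧-intro (⊢-trans (⊢-∧-elimˡ h) (ax (S3ax φ φ'))) (⊢-trans (⊢-∧-elimʳ h) (ax (S3ax φ' φ)))

≡ₛ-subst : ∀ {e} {σ σ' : ℕ → Fm} → (∀ n → e ⊢ σ n ≡ₛ σ' n) → ∀ φ → e ⊢ subst σ φ ≡ₛ subst σ' φ
≡ₛ-subst σ≡σ' (var n)  = σ≡σ' n
≡ₛ-subst σ≡σ' ⊥'       = ⊢-weaken (≡ₛ-refl ⊥')
≡ₛ-subst σ≡σ' ⊤'       = ⊢-weaken (≡ₛ-refl ⊤')
≡ₛ-subst σ≡σ' (¬' a)   = ≡ₛ-cong₁ ¬'_ mono (≡ₛ-subst σ≡σ' a)
  where mono = λ a a' → tautologyInstance ((A ⇔ B) ⇒ (¬' A ⇒ ¬' B)) (a ∷ a' ∷ [])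
≡ₛ-subst σ≡σ' (a ⇒ b)  = ≡ₛ-cong₂ _⇒_ mono (≡ₛ-subst σ≡σ' a) (≡ₛ-subst σ≡σ' b)
  where mono = λ a a' b b' → tautologyInstance ((A ⇔ B) ⇒ (C ⇔ D) ⇒ ((A ⇒ C) ⇒ (B ⇒ D))) (a ∷ a' ∷ b ∷ b' ∷ [])
≡ₛ-subst σ≡σ' (a ∨' b) = ≡ₛ-cong₂ _∨'_ mono (≡ₛ-subst σ≡σ' a) (≡ₛ-subst σ≡σ' b)
  where mono = λ a a' b b' → tautologyInstance ((A ⇔ B) ⇒ (C ⇔ D) ⇒ (A ∨' C ⇒ B ∨' D)) (a ∷ a' ∷ b ∷ b' ∷ [])
≡ₛ-subst σ≡σ' (a ∧' b) = ≡ₛ-cong₂ _∧'_ mono (≡ₛ-subst σ≡σ' a) (≡ₛ-subst σ≡σ' b)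
  where mono = λ a a' b b' → tautologyInstance ((A ⇔ B) ⇒ (C ⇔ D) ⇒ (A ∧' C ⇒ B ∧' D)) (a ∷ a' ∷ b ∷ b' ∷ [])
≡ₛ-subst σ≡σ' (□ a)    = ≡ₛ-cong-□ (≡ₛ-subst σ≡σ' a)

≡ₛ-[≔]-var : ∀ x ψ ψ' n → ψ ≡ₛ ψ' ⊢ var n [ x ≔ ψ ] ≡ₛ var n [ x ≔ ψ' ]
≡ₛ-[≔]-var x ψ ψ' n with n ≟ x
... | yes _ = ⊢-refl
... | no _  = ⊢-weaken (≡ₛ-refl (var n))

theorem31 : (φ ψ ψ' : Fm) →
    (S3⊢ (φ ≡ₛ φ)) × (S3⊢ ((φ ≡ₛ ψ) ⇒ (φ ⇒ ψ))) × ((x : ℕ) → Occurs x φ → S3⊢ ((ψ ≡ₛ ψ') ⇒ ((φ [ x ≔ ψ ]) ≡ₛ (φ [ x ≔ ψ' ]))))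
theorem31 φ ψ ψ' = ≡ₛ-refl φ , ≡ₛ-elim φ ψ , λ x _ → ≡ₛ-subst (≡ₛ-[≔]-var x ψ ψ') φ
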